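{- Let $L\in\{\mathsf{MN},\mathsf{MNF},\mathsf{MNP},\mathsf{MND},\mathsf{MNPF},\mathsf{MNDF}\}$. Then for any modal formula $A$, the following are equivalent: (1) $L\vdash A$; (2) $A$ is valid in all $L$-frames; (3) $A$ is valid in all finite $L$-frames.
   Context: The modal language has countably many propositional variables, $\bot$, $\to$ and $\Box$ (other connectives and $\Diamond$ are abbreviations). The logic $\mathsf{MN}$ has as axioms all propositional tautologies in this language and as rules Modus Ponens, Necessitation ($A/\Box A$) and RM ($A\to B / \Box A\to\Box B$). $\mathsf{MNP}$ and $\mathsf{MND}$ are obtained from $\mathsf{MN}$ by adding the axiom schemes $\neg\Box\bot$ and $\neg(\Box A\land\Box\neg A)$ respectively; $\mathsf{MNF}$, $\mathsf{MNPF}$, $\mathsf{MNDF}$ are obtained from $\mathsf{MN}$, $\mathsf{MNP}$, $\mathsf{MND}$ respectively by adding the scheme $\Box A\to\Box\Box A$. An $\mathsf{MN}$-frame is a pair $(W,\prec)$ with $W$ non-empty and $\prec$ a relation between elements of $W$ and non-empty subsets of $W$ such that $x\prec V$ and $V\subseteq U\subseteq W$ imply $x\prec U$. A satisfaction relation $\Vdash$ on it satisfies the usual Boolean clauses and: $x\Vdash\Box A$ iff for every $V$ with $x\prec V$ there is $y\in V$ with $y\Vdash A$. $A$ is valid in the frame if $x\Vdash A$ for all satisfaction relations and all $x\in W$. The frame is transitive if whenever $x\prec V$ and $y\prec U_y$ for each $y\in V$, then $x\prec\bigcup_{y\in V}U_y$; it is an $\mathsf{MNP}$-frame if every $x$ has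 some $V$ with $x\prec V$; it is an $\mathsf{MND}$-frame if for all $x\in W$, $V\subseteq W$: $x\prec V$ or $x\prec W\setminus V$. The $L$-frames are: $\mathsf{MN}$-frames for $\mathsf{MN}$; $\mathsf{MNP}$-frames for $\mathsf{MNP}$; $\mathsf{MND}$-frames for $\mathsf{MND}$; transitive $\mathsf{MN}$-frames for $\mathsf{MNF}$; transitive $\mathsf{MNP}$-frames for $\mathsf{MNPF}$; transitive $\mathsf{MND}$-frames for $\mathsf{MNDF}$. A finite frame is one with $W$ finite. -}

module Defs where

open import Level using (Level; Lift) renaming (suc to lsuc; zero to lzero)
open import Data.Nat using (ℕ)
open import Data.Bool using (Bool; true; false; if_then_else_)
open import Data.Fin using (Fin)
open import Data.Product using (Σ; _×_; _,_; ∃)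
open import Data.Sum using (_⊎_)
open import Data.Unit using (⊤)
open import Data.Empty using (⊥)
open import Relation.Nullary using (¬_)
open import Relation.Binary.PropositionalEquality using (_≡_)
open import Function.Bundles using (_⇔_; _↔_)

infixr 5 _⇒_
infix 8 □_
infix 8 ~_
infixl 6 _∧_
data Form : Set where
  var : ℕ → Form
  fal : Form
  _⇒_ : Form → Form → Form
  □_  : Form → Form

~_ : Form → Form
~ A = A ⇒ fal

_∧_ : Form → Form → Form
A ∧ B = ~ (A ⇒ ~ B)

-- Propositional tautologies in the modal language: formulas true under
-- every Boolean assignment to the variables and to the boxed subformulas
-- (boxed formulas treated as propositional atoms).

_⟹_ : Bool → Bool → Bool
true  ⟹ b = b
false ⟹ b = true

evalB : (ℕ → Bool) → (Form → Bool) → Form → Bool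
evalB v b (var n) = v n
evalB v b fal     = false
evalB v b (A ⇒ B) = evalB v b A ⟹ evalB v b B
evalB v b (□ A)   = b A

Tautology : Form → Set
Tautology A = (v : ℕ → Bool) (b : Form → Bool) → evalB v b A ≡ true

data Logic : Set where
  MN MNF MNP MND MNPF MNDF : Logic

HasP : Logic → Set
HasP MNP  = ⊤
HasP MNPF = ⊤
HasP _    = ⊥

HasD : Logic → Set
HasD MND  = ⊤
HasD MNDF = ⊤
HasD _    = ⊥

HasF : Logic → Set
HasF MNF  = ⊤
HasF MNPF = ⊤
HasF MNDF = ⊤
HasF _    = ⊥

infix 3 _⊢_
data _⊢_ (L : Logic) : Form → Set where
  taut : ∀ {A} → Tautology A → L ⊢ A
  mp   : ∀ {A B} → L ⊢ A ⇒ B → L ⊢ A → L ⊢ B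
  nec  : ∀ {A} → L ⊢ A → L ⊢ □ A
  rm   : ∀ {A B} → L ⊢ A ⇒ B → L ⊢ □ A ⇒ □ B
  axP  : HasP L → L ⊢ ~ (□ fal)
  axD  : ∀ {A} → HasD L → L ⊢ ~ (□ A ∧ □ (~ A))
  axF  : ∀ {A} → HasF L → L ⊢ □ A ⇒ □ (□ A)

Subset : Set → Set₁
Subset W = W → Set

_⊆_ : {W : Set} → Subset W → Subset W → Set
V ⊆ U = ∀ y → V y → U y

record Frame : Set₁ where
  field
    W        : Set
    inhabit  : W
    _≺_      : W → Subset W → Set
    nonempty : ∀ {x V} → x ≺ V → Σ W V
    monotone : ∀ {x V U} → x ≺ V → V ⊆ U → x ≺ U

module _ (F : Frame) where
  open Frame F

  Transitive : Set₁
  Transitive = ∀ x (V : Subset W) (U : W → Subset W) →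
    x ≺ V → (∀ y → V y → y ≺ U y) →
    x ≺ (λ z → Σ W (λ y → V y × U y z))

  IsMNP : Set₁
  IsMNP = ∀ x → Σ (Subset W) (λ V → x ≺ V)

  IsMND : Set₁
  IsMND = ∀ x (V : Subset W) → x ≺ V ⊎ x ≺ (λ y → ¬ V y)

  Finite : Set
  Finite = Σ ℕ (λ n → W ↔ Fin n)

  record IsSatisfaction (S : W → Form → Set) : Set₁ where
    field
      sat-⊥ : ∀ x → ¬ S x fal
      sat-⇒ : ∀ x A B → S x (A ⇒ B) ⇔ (¬ S x A ⊎ S x B)
      sat-□ : ∀ x A → S x (□ A) ⇔
                (∀ (V : Subset W) → x ≺ V → Σ W (λ y → V y × S y A))

  ValidIn : Form → Set₁
  ValidIn A = ∀ (S : W → Form → Set) → IsSatisfaction S → ∀ x → S x A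

IsLFrame : Logic → Frame → Set₁
IsLFrame MN   F = Lift (lsuc lzero) ⊤
IsLFrame MNF  F = Transitive F
IsLFrame MNP  F = IsMNP F
IsLFrame MND  F = IsMND F
IsLFrame MNPF F = IsMNP F × Transitive F
IsLFrame MNDF F = IsMND F × Transitive F

ValidAllL : Logic → Form → Set₁
ValidAllL L A = ∀ (F : Frame) → IsLFrame L F → ValidIn F A

ValidFiniteL : Logic → Form → Set₁
ValidFiniteL L A = ∀ (F : Frame) → IsLFrame L F → Finite F → ValidIn F A

-- For completeness, a
-- non-theorem A is refuted in a finite canonical frame: its worlds are the L-consistent
-- assignments of truth values to the subformulas Φ of □⊤ ⇒ A, and x ≺ V holds iff every
-- formula C with □C true at x (and, when L contains the F axiom, also □C itself) is true
-- at some world of V.  By RM, if □B is false at x then every formula required by x is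
-- consistent with ¬B, so the worlds falsifying B form a neighbourhood of x; this gives the
-- truth lemma for □, and P, D and F make the frame serial, dichotomous and transitive.
-- All of this is classical reasoning about arbitrary predicates, hence excluded middle.
module Submission where

open import Defs
open import Level using (Lift; lift; lower) renaming (suc to lsuc; zero to lzero)
open import Axiom.ExcludedMiddle using (ExcludedMiddle)
open import Data.Bool using (Bool; true; false)
open import Data.Empty using (⊥; ⊥-elim)
open import Data.Unit using (⊤; tt)
open import Data.Nat using (ℕ)
open import Data.Fin using (Fin)
open import Data.Product using (Σ; _×_; _,_; proj₁; proj₂)
open import Data.Sum using (_⊎_; inj₁; inj₂; [_,_])
open import Data.List using (List; []; _∷_; _++_; map; filter; length; lookup)
open import Data.List.Membership.Propositional using (_∈_)
open import Data.List.Membership.Propositional.Properties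
  using (∈-++⁺ˡ; ∈-++⁺ʳ; ∈-++⁻; ∈-map⁺; ∈-map⁻; ∈-filter⁺; ∈-filter⁻; ∈-lookup)
open import Data.List.Relation.Unary.All as All using (All; []; _∷_)
open import Data.List.Relation.Unary.All.Properties using (++⁺; ++⁻)
open import Data.List.Relation.Unary.Any using (here; there; index)
open import Data.List.Relation.Unary.Any.Properties using (lookup-index)
open import Data.Sum.Function.Propositional using (_⊎-⇔_)
open import Function.Bundles using (_⇔_; mk⇔; Equivalence)
open import Function.Construct.Identity using (⇔-id; ↔-id)
open import Function.Construct.Composition using (_⇔-∘_)
open import Function.Construct.Symmetry using (⇔-sym)
open import Function.Related.TypeIsomorphisms using (¬-cong-⇔)
open import Relation.Nullary using (¬_; Dec; yes; no; does)
open import Relation.Nullary.Decidable using (map′; True; toWitness; fromWitness; dec-true; dec-false)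
open import Relation.Binary.PropositionalEquality using (_≡_; refl; sym; trans; cong₂)

open Equivalence

⟹-intro : ∀ {a c} → (a ≡ true → c ≡ true) → (a ⟹ c) ≡ true
⟹-intro {true}  f = f refl
⟹-intro {false} f = refl

⟹-elim : ∀ {a c} → (a ⟹ c) ≡ true → a ≡ true → c ≡ true
⟹-elim e refl = e

⟹-false : ∀ {a c} → (a ⟹ c) ≡ false → a ≡ true × c ≡ false
⟹-false {true}  e = refl , e
⟹-false {false} ()

true≢false : ∀ {a} → a ≡ true → a ≡ false → ⊥
true≢false refl ()

true-⟹-false : ∀ {a} → a ≡ true → (a ⟹ false) ≡ true → ⊥
true-⟹-false refl ()

¬∧-elim : ∀ {a c} → a ≡ true → c ≡ true → (((a ⟹ (c ⟹ false)) ⟹ false) ⟹ false) ≡ true → ⊥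
¬∧-elim refl refl ()

does-⟹ : ∀ {P Q R : Set} (p? : Dec P) (q? : Dec Q) (r? : Dec R) → R ⇔ (¬ P ⊎ Q) →
         (does p? ⟹ does q?) ≡ does r?
does-⟹ (yes p) (yes q) r? r⇔ = sym (dec-true r? (from r⇔ (inj₂ q)))
does-⟹ (yes p) (no ¬q) r? r⇔ = sym (dec-false r? (λ r → [ (λ ¬p → ¬p p) , ¬q ] (to r⇔ r)))
does-⟹ (no ¬p) q?     r? r⇔ = sym (dec-true r? (from r⇔ (inj₁ ¬p)))

verum : Form
verum = fal ⇒ fal

Lit : Set
Lit = Form × Bool

Holds : (ℕ → Bool) → (Form → Bool) → Lit → Set
Holds v b (B , β) = evalB v b B ≡ β

module Refutation (L : Logic) where

  tautological-consequence : ∀ {Hs C} → All (L ⊢_) Hs →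
    (∀ v b → All (λ H → evalB v b H ≡ true) Hs → evalB v b C ≡ true) → L ⊢ C
  tautological-consequence []       f = taut (λ v b → f v b [])
  tautological-consequence (p ∷ ps) f =
    mp (tautological-consequence ps (λ v b hs → ⟹-intro (λ h → f v b (h ∷ hs)))) p

  ⊢-⇒-trans : ∀ {A B C} → L ⊢ A ⇒ B → L ⊢ B ⇒ C → L ⊢ A ⇒ C
  ⊢-⇒-trans {A} {B} {C} p q = tautological-consequence (p ∷ q ∷ [])
    (λ { v b (h ∷ h′ ∷ []) → ⟹-intro (λ a → ⟹-elim h′ (⟹-elim {c = evalB v b B} h a)) })

  Inconsistent : List Lit → Set
  Inconsistent Γ = Σ (List Form) λ Hs → All (L ⊢_) Hs ×
    (∀ v b → All (λ H → evalB v b H ≡ true) Hs → ¬ All (Holds v b) Γ)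

  Consistent : List Lit → Set
  Consistent Γ = ¬ Inconsistent Γ

  Inconsistent-mono : ∀ {Γ Δ} → All (_∈ Δ) Γ → Inconsistent Γ → Inconsistent Δ
  Inconsistent-mono Γ⊆Δ (Hs , ⊢Hs , refute) =
    Hs , ⊢Hs , λ v b hs hΔ → refute v b hs (All.map (All.lookup hΔ) Γ⊆Δ)

  Inconsistent-cut : ∀ {C Δ} → Inconsistent ((C , true) ∷ Δ) → Inconsistent ((C , false) ∷ Δ) →
                     Inconsistent Δ
  Inconsistent-cut {C} {Δ} (Hs , ⊢Hs , refute) (Hs′ , ⊢Hs′ , refute′) =
    Hs ++ Hs′ , ++⁺ ⊢Hs ⊢Hs′ , refute-Δ
    where
    refute-Δ : ∀ v b → All (λ H → evalB v b H ≡ true) (Hs ++ Hs′) → ¬ All (Holds v b) Δ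
    refute-Δ v b hs hΔ with ++⁻ Hs hs | evalB v b C in eq
    ... | h , _  | true  = refute v b h (eq ∷ hΔ)
    ... | _ , h′ | false = refute′ v b h′ (eq ∷ hΔ)

  refutation-derives : ∀ {Γ C} → Inconsistent Γ →
    (∀ v b → evalB v b C ≡ false → All (Holds v b) Γ) → L ⊢ C
  refutation-derives {C = C} (Hs , ⊢Hs , refute) falsifies =
    tautological-consequence ⊢Hs verifies
    where
    verifies : ∀ v b → All (λ H → evalB v b H ≡ true) Hs → evalB v b C ≡ true
    verifies v b hs with evalB v b C in eq
    ... | true  = refl
    ... | false = ⊥-elim (refute v b hs (falsifies v b eq))

  Inconsistent-clash : ∀ {Γ B} → (B , true) ∈ Γ → (B , false) ∈ Γ → Inconsistent Γ
  Inconsistent-clash m m′ =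
    Inconsistent-mono (m ∷ m′ ∷ []) ([] , [] , λ { v b [] (t ∷ f ∷ []) → true≢false t f })

  Consistent-functional : ∀ {Γ B β β′} → Consistent Γ → (B , β) ∈ Γ → (B , β′) ∈ Γ → β ≡ β′
  Consistent-functional {β = true}  {true}  c m m′ = refl
  Consistent-functional {β = false} {false} c m m′ = refl
  Consistent-functional {β = true}  {false} c m m′ = ⊥-elim (c (Inconsistent-clash m m′))
  Consistent-functional {β = false} {true}  c m m′ = ⊥-elim (c (Inconsistent-clash m′ m))

subformulas : Form → List Form
subformulas (var n) = var n ∷ []
subformulas fal     = fal ∷ []
subformulas (A ⇒ B) = (A ⇒ B) ∷ subformulas A ++ subformulas B
subformulas (□ A)   = □ A ∷ subformulas A

subformulas-self : ∀ A → A ∈ subformulas A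
subformulas-self (var n) = here refl
subformulas-self fal     = here refl
subformulas-self (A ⇒ B) = here refl
subformulas-self (□ A)   = here refl

subformulas-trans : ∀ A {B C} → B ∈ subformulas A → C ∈ subformulas B → C ∈ subformulas A
subformulas-trans (var n) (here refl) m = m
subformulas-trans fal     (here refl) m = m
subformulas-trans (A ⇒ B) (here refl) m = m
subformulas-trans (A ⇒ B) (there m′) m with ∈-++⁻ (subformulas A) m′
... | inj₁ mA = there (∈-++⁺ˡ (subformulas-trans A mA m))
... | inj₂ mB = there (∈-++⁺ʳ (subformulas A) (subformulas-trans B mB m))
subformulas-trans (□ A)   (here refl) m = m
subformulas-trans (□ A)   (there m′) m = there (subformulas-trans A m′ m)

record SubformulaClosed (Φ : List Form) : Set where
  field
    ⇒ˡ-closed : ∀ {B C} → (B ⇒ C) ∈ Φ → B ∈ Φ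
    ⇒ʳ-closed : ∀ {B C} → (B ⇒ C) ∈ Φ → C ∈ Φ
    □-closed  : ∀ {B} → □ B ∈ Φ → B ∈ Φ

subformulas-closed : ∀ A → SubformulaClosed (subformulas A)
subformulas-closed A = record
  { ⇒ˡ-closed = λ {B} m → subformulas-trans A m (there (∈-++⁺ˡ (subformulas-self B)))
  ; ⇒ʳ-closed = λ {B} {C} m →
      subformulas-trans A m (there (∈-++⁺ʳ (subformulas B) (subformulas-self C)))
  ; □-closed  = λ {B} m → subformulas-trans A m (there (subformulas-self B))
  }

data Assignment : List Form → List Lit → Set where
  []  : Assignment [] []
  _∷_ : ∀ {C Φ w} β → Assignment Φ w → Assignment (C ∷ Φ) ((C , β) ∷ w)

assignment-complete : ∀ {Φ w B} → Assignment Φ w → B ∈ Φ → Σ Bool λ β → (B , β) ∈ w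
assignment-complete (β ∷ a) (here refl) = β , here refl
assignment-complete (β ∷ a) (there m) with assignment-complete a m
... | β′ , m′ = β′ , there m′

assignment-over : ∀ {Φ w B β} → Assignment Φ w → (B , β) ∈ w → B ∈ Φ
assignment-over (β ∷ a) (here refl) = here refl
assignment-over (β ∷ a) (there m)   = there (assignment-over a m)

assignments : List Form → List (List Lit)
assignments []      = [] ∷ []
assignments (C ∷ Φ) = map ((C , true) ∷_) (assignments Φ) ++ map ((C , false) ∷_) (assignments Φ)

∈-assignments⁺ : ∀ {Φ w} → Assignment Φ w → w ∈ assignments Φ
∈-assignments⁺ []                = here refl
∈-assignments⁺ (true ∷ a)        = ∈-++⁺ˡ (∈-map⁺ _ (∈-assignments⁺ a))
∈-assignments⁺ {C ∷ Φ} (false ∷ a) =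
  ∈-++⁺ʳ (map ((C , true) ∷_) (assignments Φ)) (∈-map⁺ _ (∈-assignments⁺ a))

∈-assignments⁻ : ∀ Φ {w} → w ∈ assignments Φ → Assignment Φ w
∈-assignments⁻ []      (here refl) = []
∈-assignments⁻ (C ∷ Φ) m with ∈-++⁻ (map ((C , true) ∷_) (assignments Φ)) m
... | inj₁ m⁺ with ∈-map⁻ _ m⁺
...   | w , m′ , refl = true ∷ ∈-assignments⁻ Φ m′
∈-assignments⁻ (C ∷ Φ) m | inj₂ m⁻ with ∈-map⁻ _ m⁻
...   | w , m′ , refl = false ∷ ∈-assignments⁻ Φ m′

IsLFrame-P : ∀ {L F} → IsLFrame L F → HasP L → IsMNP F
IsLFrame-P {MNP}  p       _ = p
IsLFrame-P {MNPF} (p , _) _ = p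

IsLFrame-D : ∀ {L F} → IsLFrame L F → HasD L → IsMND F
IsLFrame-D {MND}  d       _ = d
IsLFrame-D {MNDF} (d , _) _ = d

IsLFrame-F : ∀ {L F} → IsLFrame L F → HasF L → Transitive F
IsLFrame-F {MNF}  t       _ = t
IsLFrame-F {MNPF} (_ , t) _ = t
IsLFrame-F {MNDF} (_ , t) _ = t

IsLFrame-intro : ∀ L {F} → (HasP L → IsMNP F) → (HasD L → IsMND F) → (HasF L → Transitive F) →
                 IsLFrame L F
IsLFrame-intro MN   p d t = lift tt
IsLFrame-intro MNF  p d t = t tt
IsLFrame-intro MNP  p d t = p tt
IsLFrame-intro MND  p d t = d tt
IsLFrame-intro MNPF p d t = p tt , t tt
IsLFrame-intro MNDF p d t = d tt , t tt

module Classical (em : ExcludedMiddle (lsuc lzero)) where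

  dec : (P : Set) → Dec P
  dec P = map′ lower lift (em {Lift (lsuc lzero) P})

  ¬¬-elim : ∀ {P : Set} → ¬ ¬ P → P
  ¬¬-elim {P} ¬¬p with dec P
  ... | yes p = p
  ... | no ¬p = ⊥-elim (¬¬p ¬p)

  -- Needed for the □ clause of the canonical satisfaction relation, which quantifies over
  -- Subset W and hence lives in Set₁.
  ⌊_⌋ : Set₁ → Set
  ⌊ P ⌋ = True (em {P})

  ⌊⌋⇔ : ∀ {P} → ⌊ P ⌋ ⇔ P
  ⌊⌋⇔ = mk⇔ toWitness fromWitness

  module Soundness {F : Frame} {S : Frame.W F → Form → Set} (sat : IsSatisfaction F S) where
    open Frame F
    open IsSatisfaction sat

    ⇒-intro : ∀ {x A B} → (S x A → S x B) → S x (A ⇒ B)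
    ⇒-intro {x} {A} {B} f with dec (S x A)
    ... | yes a = from (sat-⇒ x A B) (inj₂ (f a))
    ... | no ¬a = from (sat-⇒ x A B) (inj₁ ¬a)

    ⇒-elim : ∀ {x A B} → S x (A ⇒ B) → S x A → S x B
    ⇒-elim {x} {A} {B} s a with to (sat-⇒ x A B) s
    ... | inj₁ ¬a = ⊥-elim (¬a a)
    ... | inj₂ b  = b

    ~-intro : ∀ {x A} → ¬ S x A → S x (~ A)
    ~-intro ¬a = ⇒-intro (λ a → ⊥-elim (¬a a))

    ~-elim : ∀ {x A} → S x (~ A) → ¬ S x A
    ~-elim {x} s a = sat-⊥ x (⇒-elim s a)

    ∧-elim : ∀ {x A B} → S x (A ∧ B) → S x A × S x B
    ∧-elim s = ¬¬-elim (λ ¬a → ~-elim s (⇒-intro (λ a → ⊥-elim (¬a a))))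
             , ¬¬-elim (λ ¬b → ~-elim s (⇒-intro (λ _ → ~-intro ¬b)))

    atoms : W → ℕ → Bool
    atoms x n = does (dec (S x (var n)))

    boxes : W → Form → Bool
    boxes x B = does (dec (S x (□ B)))

    evalB-world : ∀ x A → evalB (atoms x) (boxes x) A ≡ does (dec (S x A))
    evalB-world x (var n) = refl
    evalB-world x fal = sym (dec-false (dec (S x fal)) (sat-⊥ x))
    evalB-world x (A ⇒ B) = trans (cong₂ _⟹_ (evalB-world x A) (evalB-world x B))
                                  (does-⟹ (dec (S x A)) (dec (S x B)) (dec (S x (A ⇒ B))) (sat-⇒ x A B))
    evalB-world x (□ A) = refl

    sound-taut : ∀ {A} → Tautology A → ∀ x → S x A
    sound-taut {A} t x = ¬¬-elim λ ¬a →
      true≢false (trans (sym (evalB-world x A)) (t (atoms x) (boxes x))) (dec-false (dec (S x A)) ¬a)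

    □-or-refuting-neighbourhood : ∀ y A → S y (□ A) ⊎ y ≺ (λ z → ¬ S z A)
    □-or-refuting-neighbourhood y A with dec (y ≺ (λ z → ¬ S z A))
    ... | yes y≺ = inj₂ y≺
    ... | no ¬y≺ = inj₁ (from (sat-□ y A) λ V y≺V → ¬¬-elim λ none →
                     ¬y≺ (monotone y≺V (λ z z∈V a → none (z , z∈V , a))))

    sound-P : IsMNP F → ∀ x → S x (~ (□ fal))
    sound-P serial x = ~-intro λ s →
      let V , x≺V = serial x ; y , _ , ⊥y = to (sat-□ x fal) s V x≺V in sat-⊥ y ⊥y

    sound-D : IsMND F → ∀ {A} x → S x (~ (□ A ∧ □ (~ A)))
    sound-D dichotomy {A} x = ~-intro λ s →
      let □a , □¬a = ∧-elim s in refute □a □¬a (dichotomy x (λ y → S y A))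
      where
      refute : S x (□ A) → S x (□ (~ A)) → x ≺ (λ y → S y A) ⊎ x ≺ (λ y → ¬ S y A) → ⊥
      refute _  □¬a (inj₁ x≺A)  = let _ , a , ¬a = to (sat-□ x (~ A)) □¬a _ x≺A in ~-elim ¬a a
      refute □a _   (inj₂ x≺¬A) = let _ , ¬a , a = to (sat-□ x A) □a _ x≺¬A in ¬a a

    -- If no world of V satisfied □A, each would have a neighbourhood without A-worlds, and
    -- by transitivity their union would be such a neighbourhood of x.
    sound-F : Transitive F → ∀ {A} x → S x (□ A ⇒ □ (□ A))
    sound-F transitive {A} x = ⇒-intro λ □a → from (sat-□ x (□ A)) λ V x≺V → ¬¬-elim λ none →
      let _ , (_ , _ , ¬a) , a = to (sat-□ x A) □a _
            (transitive x V (λ _ z → ¬ S z A) x≺V (refuting {V} none))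
      in ¬a a
      where
      refuting : ∀ {V} → ¬ Σ W (λ y → V y × S y (□ A)) → ∀ y → V y → y ≺ (λ z → ¬ S z A)
      refuting none y y∈V with □-or-refuting-neighbourhood y A
      ... | inj₁ □a = ⊥-elim (none (y , y∈V , □a))
      ... | inj₂ y≺ = y≺

    sound : ∀ {L A} → IsLFrame L F → L ⊢ A → ∀ x → S x A
    sound fr (taut t) x = sound-taut t x
    sound fr (mp p q) x = ⇒-elim (sound fr p x) (sound fr q x)
    sound fr (nec {A} p) x = from (sat-□ x A) λ V x≺V →
      let y , y∈V = nonempty x≺V in y , y∈V , sound fr p y
    sound fr (rm {A} {B} p) x = ⇒-intro λ □a → from (sat-□ x B) λ V x≺V →
      let y , y∈V , a = to (sat-□ x A) □a V x≺V in y , y∈V , ⇒-elim (sound fr p y) a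
    sound fr (axP hasP) x = sound-P (IsLFrame-P fr hasP) x
    sound fr (axD hasD) x = sound-D (IsLFrame-D fr hasD) x
    sound fr (axF hasF) x = sound-F (IsLFrame-F fr hasF) x

  soundness : ∀ {L A} → L ⊢ A → ValidAllL L A
  soundness p F fr S sat x = Soundness.sound sat fr p x

  module Lindenbaum (L : Logic) where
    open Refutation L

    consistent-extension : ∀ {Δ} C → Consistent Δ → Σ Bool λ β → Consistent ((C , β) ∷ Δ)
    consistent-extension {Δ} C c with dec (Inconsistent ((C , true) ∷ Δ))
    ... | yes i⁺ = false , λ i⁻ → c (Inconsistent-cut i⁺ i⁻)
    ... | no c⁺  = true , c⁺

    lindenbaum : ∀ Ψ {Δ} → Consistent Δ → Σ (List Lit) λ w → Assignment Ψ w × Consistent (w ++ Δ)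
    lindenbaum []      c = [] , [] , c
    lindenbaum (C ∷ Ψ) c with lindenbaum Ψ c
    ... | w , a , c′ with consistent-extension C c′
    ... | β , c″ = (C , β) ∷ w , β ∷ a , c″

  module Canonical (L : Logic) (Φ : List Form) (closed : SubformulaClosed Φ) (□verum∈Φ : □ verum ∈ Φ)
    where
    open Refutation L
    open Lindenbaum L
    open SubformulaClosed closed

    consistent? : ∀ w → Dec (Consistent w)
    consistent? w = dec (Consistent w)

    worlds : List (List Lit)
    worlds = filter consistent? (assignments Φ)

    -- Worlds are positions in this list, so the canonical frame is finite by construction.
    W : Set
    W = Fin (length worlds)

    infix 4 _∋_
    _∋_ : W → Lit → Set
    x ∋ l = l ∈ lookup worlds x

    world-consistent : ∀ x → Consistent (lookup worlds x)
    world-consistent x = proj₂ (∈-filter⁻ consistent? {xs = assignments Φ} (∈-lookup x))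

    world-assignment : ∀ x → Assignment Φ (lookup worlds x)
    world-assignment x = ∈-assignments⁻ Φ (proj₁ (∈-filter⁻ consistent? {xs = assignments Φ} (∈-lookup x)))

    world-index : ∀ {w} → Assignment Φ w → Consistent w → Σ W λ x → lookup worlds x ≡ w
    world-index a c = index m , sym (lookup-index m)
      where m = ∈-filter⁺ consistent? (∈-assignments⁺ a) c

    world-decides : ∀ x {B} → B ∈ Φ → x ∋ (B , true) ⊎ x ∋ (B , false)
    world-decides x B∈Φ with assignment-complete (world-assignment x) B∈Φ
    ... | true  , m = inj₁ m
    ... | false , m = inj₂ m

    world-over : ∀ x {B β} → x ∋ (B , β) → B ∈ Φ
    world-over x = assignment-over (world-assignment x)

    world-irrefutable : ∀ x {Γ} → All (x ∋_) Γ → ¬ Inconsistent Γ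
    world-irrefutable x Γ∈x i = world-consistent x (Inconsistent-mono Γ∈x i)

    world-satisfiable : ∀ x {Γ} → All (x ∋_) Γ → ¬ (∀ v b → ¬ All (Holds v b) Γ)
    world-satisfiable x Γ∈x unsat = world-irrefutable x Γ∈x ([] , [] , λ v b _ → unsat v b)

    world-clash : ∀ x {B} → x ∋ (B , true) → x ∋ (B , false) → ⊥
    world-clash x m m′ with Consistent-functional (world-consistent x) m m′
    ... | ()

    world-theorem : ∀ x {B} → L ⊢ B → B ∈ Φ → x ∋ (B , true)
    world-theorem x p B∈Φ with world-decides x B∈Φ
    ... | inj₁ m  = m
    ... | inj₂ m′ = ⊥-elim (world-irrefutable x (m′ ∷ [])
                      (_ ∷ [] , p ∷ [] , λ { v b (h ∷ []) (f ∷ []) → true≢false h f }))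

    world-mp : ∀ x {A B} → x ∋ (A , true) → L ⊢ A ⇒ B → x ∋ (B , false) → ⊥
    world-mp x a p ¬b = world-irrefutable x (a ∷ ¬b ∷ [])
      (_ ∷ [] , p ∷ [] , λ { v b (h ∷ []) (t ∷ f ∷ []) → true≢false (⟹-elim h t) f })

    world-¬ : ∀ x {A} → x ∋ (A , true) → L ⊢ ~ A → ⊥
    world-¬ x a p = world-irrefutable x (a ∷ [])
      (_ ∷ [] , p ∷ [] , λ { v b (h ∷ []) (t ∷ []) → true-⟹-false t h })

    extend : ∀ {Δ} → All (λ l → proj₁ l ∈ Φ) Δ → Consistent Δ → Σ W λ y → All (y ∋_) Δ
    extend {Δ} over c with lindenbaum Φ c
    ... | w , a , c′ with world-index a (λ i → c′ (Inconsistent-mono (All.tabulate ∈-++⁺ˡ) i))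
    ... | y , refl = y , All.tabulate agree
      where
      agree : ∀ {l} → l ∈ Δ → l ∈ w
      agree {B , β} l∈Δ with assignment-complete a (All.lookup over l∈Δ)
      ... | β′ , m with Consistent-functional c′ (∈-++⁺ʳ w l∈Δ) (∈-++⁺ˡ m)
      ... | refl = m

    extend-or-refute : ∀ {Δ} → All (λ l → proj₁ l ∈ Φ) Δ → Inconsistent Δ ⊎ Σ W λ y → All (y ∋_) Δ
    extend-or-refute {Δ} over with dec (Inconsistent Δ)
    ... | yes i = inj₁ i
    ... | no c  = inj₂ (extend over c)

    -- The boxed requirements, present only with the F axiom, are what make ≺ transitive.
    data Requires (x : W) : Form → Set where
      body  : ∀ {C} → x ∋ (□ C , true) → Requires x C
      boxed : ∀ {C} → HasF L → x ∋ (□ C , true) → Requires x (□ C)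

    _≺_ : W → Subset W → Set
    x ≺ V = ∀ {D} → Requires x D → Σ W λ y → V y × y ∋ (D , true)

    requires-∈Φ : ∀ {x D} → Requires x D → D ∈ Φ
    requires-∈Φ {x} (body m)    = □-closed (world-over x m)
    requires-∈Φ {x} (boxed _ m) = world-over x m

    requires-⇒ : ∀ {x D E} → Requires x D → L ⊢ D ⇒ E → Σ Form λ C → x ∋ (□ C , true) × L ⊢ □ C ⇒ □ E
    requires-⇒ (body m)    p = _ , m , rm p
    requires-⇒ (boxed f m) p = _ , m , ⊢-⇒-trans (axF f) (rm p)

    -- □⊤ is a theorem, so every world requires ⊤.
    ≺-nonempty : ∀ {x V} → x ≺ V → Σ W V
    ≺-nonempty {x} x≺V =
      let y , y∈V , _ = x≺V (body (world-theorem x (nec (taut (λ v b → refl))) □verum∈Φ)) in y , y∈V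

    ≺-monotone : ∀ {x V U} → x ≺ V → V ⊆ U → x ≺ U
    ≺-monotone x≺V V⊆U r = let y , y∈V , m = x≺V r in y , V⊆U y y∈V , m

    canonical : W → Frame
    canonical x₀ = record
      { W = W ; inhabit = x₀ ; _≺_ = _≺_ ; nonempty = ≺-nonempty ; monotone = ≺-monotone }

    ≺-serial : HasP L → ∀ x → x ≺ (λ _ → ⊤)
    ≺-serial hasP x r with extend-or-refute (requires-∈Φ r ∷ [])
    ... | inj₂ (y , D∈y ∷ []) = y , tt , D∈y
    ... | inj₁ i with requires-⇒ {E = fal} r (refutation-derives i λ v b e → proj₁ (⟹-false e) ∷ [])
    ... | C , □C∈x , p = ⊥-elim (world-¬ x □C∈x (⊢-⇒-trans p (axP hasP)))

    ≺-dichotomy : HasD L → ∀ x V → x ≺ V ⊎ x ≺ (λ y → ¬ V y)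
    ≺-dichotomy hasD x V with dec (Σ Form λ D → Requires x D × (∀ y → V y → ¬ y ∋ (D , true)))
    ... | no none = inj₁ λ r → ¬¬-elim λ ¬w → none (_ , r , λ y v m → ¬w (y , v , m))
    ... | yes (D₁ , r₁ , outside) = inj₂ λ r₂ → witness r₂
      where
      witness : ∀ {D₂} → Requires x D₂ → Σ W λ y → ¬ V y × y ∋ (D₂ , true)
      witness {D₂} r₂ with extend-or-refute (requires-∈Φ r₁ ∷ requires-∈Φ r₂ ∷ [])
      ... | inj₂ (y , D₁∈y ∷ D₂∈y ∷ []) = y , (λ v → outside y v D₁∈y) , D₂∈y
      ... | inj₁ i with requires-⇒ {E = ~ D₂} r₁ (refutation-derives i λ v b e →
                          let d₁ , e′ = ⟹-false e in d₁ ∷ proj₁ (⟹-false e′) ∷ [])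
                      | requires-⇒ {E = D₂} r₂ (taut (λ v b → ⟹-intro {evalB v b D₂} (λ d → d)))
      ... | C₁ , □C₁∈x , p₁ | C₂ , □C₂∈x , p₂ =
        ⊥-elim (world-irrefutable x (□C₁∈x ∷ □C₂∈x ∷ [])
          (_ ∷ _ ∷ _ ∷ [] , p₁ ∷ p₂ ∷ axD hasD ∷ [] ,
           λ { v b (h₁ ∷ h₂ ∷ h ∷ []) (c₁ ∷ c₂ ∷ []) →
                 ¬∧-elim (⟹-elim {c = b D₂} h₂ c₂) (⟹-elim {c = b (~ D₂)} h₁ c₁) h }))

    ≺-transitive : ∀ {x₀} → HasF L → Transitive (canonical x₀)
    ≺-transitive f x V U x≺V y≺U (body m) with x≺V (boxed f m)
    ... | y , y∈V , □C∈y with y≺U y y∈V (body □C∈y)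
    ... | z , z∈U , C∈z = z , (y , y∈V , z∈U) , C∈z
    ≺-transitive f x V U x≺V y≺U (boxed f′ m) with x≺V (boxed f′ m)
    ... | y , y∈V , □C∈y with y≺U y y∈V (boxed f′ □C∈y)
    ... | z , z∈U , □C∈z = z , (y , y∈V , z∈U) , □C∈z

    canonical-is-L : ∀ x₀ → IsLFrame L (canonical x₀)
    canonical-is-L x₀ =
      IsLFrame-intro L {canonical x₀} (λ hasP x → _ , ≺-serial hasP x) ≺-dichotomy (≺-transitive {x₀})

    infix 4 _⊩_
    _⊩_ : W → Form → Set
    x ⊩ var k = x ∋ (var k , true)
    x ⊩ fal   = ⊥
    x ⊩ B ⇒ C = ¬ x ⊩ B ⊎ x ⊩ C
    x ⊩ □ B   = ⌊ (∀ V → x ≺ V → Σ W λ y → V y × y ⊩ B) ⌋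

    ⊩-satisfaction : ∀ x₀ → IsSatisfaction (canonical x₀) _⊩_
    ⊩-satisfaction x₀ = record
      { sat-⊥ = λ x ()
      ; sat-⇒ = λ x B C → ⇔-id _
      ; sat-□ = λ x B → ⌊⌋⇔
      }

    world-⇒ : ∀ x {B C} → (B ⇒ C) ∈ Φ → x ∋ (B ⇒ C , true) ⇔ (¬ x ∋ (B , true) ⊎ x ∋ (C , true))
    world-⇒ x {B} {C} B⇒C∈Φ = mk⇔ split join
      where
      split : x ∋ (B ⇒ C , true) → ¬ x ∋ (B , true) ⊎ x ∋ (C , true)
      split m with world-decides x (⇒ˡ-closed B⇒C∈Φ) | world-decides x (⇒ʳ-closed B⇒C∈Φ)
      ... | inj₂ ¬b | _      = inj₁ (λ b → world-clash x b ¬b)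
      ... | inj₁ _  | inj₁ c = inj₂ c
      ... | inj₁ b  | inj₂ ¬c = ⊥-elim (world-satisfiable x (m ∷ b ∷ ¬c ∷ [])
              λ { v b′ (i ∷ t ∷ f ∷ []) → true≢false (⟹-elim i t) f })
      join : ¬ x ∋ (B , true) ⊎ x ∋ (C , true) → x ∋ (B ⇒ C , true)
      join bc with world-decides x B⇒C∈Φ | world-decides x (⇒ˡ-closed B⇒C∈Φ) | bc
      ... | inj₁ m  | _      | _       = m
      ... | inj₂ _  | inj₁ b | inj₁ ¬b = ⊥-elim (¬b b)
      ... | inj₂ ¬m | inj₂ ¬b | inj₁ _ = ⊥-elim (world-satisfiable x (¬m ∷ ¬b ∷ [])
              λ { v b′ (i ∷ f ∷ []) → true≢false (proj₁ (⟹-false i)) f })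
      ... | inj₂ ¬m | _      | inj₂ c  = ⊥-elim (world-satisfiable x (¬m ∷ c ∷ [])
              λ { v b′ (i ∷ t ∷ []) → true≢false t (proj₂ (⟹-false i)) })

    falsifiers-≺ : ∀ x {B} → x ∋ (□ B , false) → x ≺ (λ y → y ∋ (B , false))
    falsifiers-≺ x {B} ¬□B r with extend-or-refute (□-closed (world-over x ¬□B) ∷ requires-∈Φ r ∷ [])
    ... | inj₂ (y , ¬B ∷ D ∷ []) = y , ¬B , D
    ... | inj₁ i with requires-⇒ r (refutation-derives i λ v b e → let d , ¬b = ⟹-false e in ¬b ∷ d ∷ [])
    ... | C , □C∈x , p = ⊥-elim (world-mp x □C∈x p ¬□B)

    truth : ∀ B → B ∈ Φ → ∀ x → x ⊩ B ⇔ x ∋ (B , true)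
    truth (var k) _ x = ⇔-id _
    truth fal     _ x = mk⇔ ⊥-elim (λ m → world-satisfiable x (m ∷ []) λ { v b (() ∷ []) })
    truth (B ⇒ C) B⇒C∈Φ x = ⇔-sym (world-⇒ x B⇒C∈Φ) ⇔-∘
      (¬-cong-⇔ (truth B (⇒ˡ-closed B⇒C∈Φ) x) ⊎-⇔ truth C (⇒ʳ-closed B⇒C∈Φ) x)
    truth (□ B) □B∈Φ x = mk⇔ forth back
      where
      B∈Φ = □-closed □B∈Φ
      forth : x ⊩ □ B → x ∋ (□ B , true)
      forth s with world-decides x □B∈Φ
      ... | inj₁ m  = m
      ... | inj₂ ¬m = let y , ¬b , b = to ⌊⌋⇔ s _ (falsifiers-≺ x ¬m)
                      in ⊥-elim (world-clash y (to (truth B B∈Φ y) b) ¬b)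
      back : x ∋ (□ B , true) → x ⊩ □ B
      back m = from ⌊⌋⇔ witnesses
        where
        witnesses : ∀ V → x ≺ V → Σ W λ y → V y × y ⊩ B
        witnesses V x≺V = let y , y∈V , b = x≺V (body m) in y , y∈V , from (truth B B∈Φ y) b

    refuting-world : ∀ {A} → ¬ (L ⊢ A) → A ∈ Φ → Σ W λ y → ¬ y ⊩ A
    refuting-world {A} ¬⊢A A∈Φ with extend-or-refute (A∈Φ ∷ [])
    ... | inj₁ i = ⊥-elim (¬⊢A (refutation-derives i λ v b e → e ∷ []))
    ... | inj₂ (y , ¬a ∷ []) = y , λ a → world-clash y (to (truth A A∈Φ y) a) ¬a

  completeness : ∀ {L A} → ValidFiniteL L A → L ⊢ A
  completeness {L} {A} valid with dec (L ⊢ A)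
  ... | yes p  = p
  ... | no ¬⊢A =
    let y , ¬a = refuting-world ¬⊢A (there (∈-++⁺ʳ (subformulas (□ verum)) (subformulas-self A)))
    in ⊥-elim (¬a (valid (canonical y) (canonical-is-L y) (length worlds , ↔-id W)
                         _⊩_ (⊩-satisfaction y) y))
    where
    open Canonical L (subformulas (□ verum ⇒ A)) (subformulas-closed (□ verum ⇒ A))
                     (there (∈-++⁺ˡ {xs = subformulas (□ verum)} (here refl)))

theorem3p5 : ExcludedMiddle (lsuc lzero) → (L : Logic) (A : Form) →
    ((L ⊢ A) ⇔ ValidAllL L A) × ((L ⊢ A) ⇔ ValidFiniteL L A)
theorem3p5 em L A =
    mk⇔ soundness (λ valid → completeness (λ F fr _ → valid F fr))
  , mk⇔ (λ p F fr _ → soundness p F fr) completeness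
  where open Classical em
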